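{- Let $C_n$ denote the cycle of order $n$. (1) For every integer $n\ge 4$, $D_{\max}(C_n)=D'_{\max}(C_n)=2$. (2) $\chi_{D,\max}(C_4)=4$ and, for every integer $n\ge 5$, $\chi_{D,\max}(C_n)=3$. (3) For every integer $n\ge 4$, $\chi'_{D,\max}(C_n)=3$.
   Context: An orientation of a simple graph assigns one direction to each edge. An automorphism of an oriented graph is a permutation $\phi$ of its vertices such that $\phi(u)\phi(v)$ is an arc whenever $uv$ is an arc. An $r$-vertex-labelling maps vertices to $\{1,\dots,r\}$, an $r$-arc-labelling maps arcs to $\{1,\dots,r\}$; colourings are proper labellings (adjacent vertices, resp. arcs sharing an end-vertex, get distinct labels). A labelling $\lambda$ is distinguishing if the only automorphism $\phi$ with $\lambda(\phi(u))=\lambda(u)$ for all vertices (resp. $\lambda(\phi(u)\phi(v))=\lambda(uv)$ for all arcs) is the identity. For an oriented graph $\vec G$, $D(\vec G)$, $\chi_D(\vec G)$, $D'(\vec G)$, $\chi'_D(\vec G)$ are the least $r$ for which $\vec G$ admits a distinguishing $r$-vertex-labelling, $r$-vertex-colouring, $r$-arc-labelling, $r$-arc-colouring. For an undirected graph $G$, $D_{\max}(G)$, $\chi_{D,\max}(G)$, $D'_{\max}(G)$, $\chi'_{D,\max}(G)$ are the maxima of these respective parameters over all orientations of $G$. -}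

module Defs where

open import Data.Nat using (ℕ; zero; suc; _∸_; _≤_)
open import Data.Fin using (Fin; toℕ)
open import Data.Bool using (Bool; true)
open import Data.Product using (Σ; _×_; _,_)
open import Data.Sum using (_⊎_)
open import Relation.Binary.PropositionalEquality using (_≡_; _≢_)
open import Relation.Nullary using (¬_)
open import Data.Fin.Permutation using (Permutation′; _⟨$⟩ʳ_)

Graph : ℕ → Set₁
Graph n = Fin n → Fin n → Set

CycStep : (n : ℕ) → Fin n → Fin n → Set
CycStep n i j = (toℕ j ≡ suc (toℕ i)) ⊎ ((toℕ i ≡ n ∸ 1) × (toℕ j ≡ 0))

Cycle : (n : ℕ) → Graph n
Cycle n i j = CycStep n i j ⊎ CycStep n j i

Digraph : ℕ → Set
Digraph n = Fin n → Fin n → Bool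

Arc : ∀ {n} → Digraph n → Fin n → Fin n → Set
Arc A u v = A u v ≡ true

IsOrientation : ∀ {n} → Graph n → Digraph n → Set
IsOrientation {n} G A =
  (∀ u v → Arc A u v → G u v) ×
  (∀ u v → G u v → Arc A u v ⊎ Arc A v u) ×
  (∀ u v → ¬ (Arc A u v × Arc A v u))

IsAut : ∀ {n} → Digraph n → Permutation′ n → Set
IsAut {n} A φ = ∀ u v → Arc A u v → Arc A (φ ⟨$⟩ʳ u) (φ ⟨$⟩ʳ v)

IsIdentity : ∀ {n} → Permutation′ n → Set
IsIdentity {n} φ = ∀ u → φ ⟨$⟩ʳ u ≡ u

-- r-vertex-labellings: Fin n → Fin r (labels {1..r} ≅ Fin r).
-- r-arc-labellings: functions on ordered pairs; only values on arcs matter.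
VDistinguishing : ∀ {n r} → Digraph n → (Fin n → Fin r) → Set
VDistinguishing {n} A λ′ =
  ∀ (φ : Permutation′ n) → IsAut A φ →
    (∀ u → λ′ (φ ⟨$⟩ʳ u) ≡ λ′ u) → IsIdentity φ

ADistinguishing : ∀ {n r} → Digraph n → (Fin n → Fin n → Fin r) → Set
ADistinguishing {n} A λ′ =
  ∀ (φ : Permutation′ n) → IsAut A φ →
    (∀ u v → Arc A u v → λ′ (φ ⟨$⟩ʳ u) (φ ⟨$⟩ʳ v) ≡ λ′ u v) → IsIdentity φ

VProper : ∀ {n r} → Digraph n → (Fin n → Fin r) → Set
VProper {n} A λ′ = ∀ u v → Arc A u v → λ′ u ≢ λ′ v

AProper : ∀ {n r} → Digraph n → (Fin n → Fin n → Fin r) → Set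
AProper {n} A λ′ =
  ∀ u v x y → Arc A u v → Arc A x y → ¬ ((u ≡ x) × (v ≡ y)) →
    ((u ≡ x) ⊎ (u ≡ y) ⊎ (v ≡ x) ⊎ (v ≡ y)) → λ′ u v ≢ λ′ x y

HasD : ∀ {n} → Digraph n → ℕ → Set
HasD {n} A r = Σ (Fin n → Fin r) λ λ′ → VDistinguishing A λ′

HasχD : ∀ {n} → Digraph n → ℕ → Set
HasχD {n} A r = Σ (Fin n → Fin r) λ λ′ → VProper A λ′ × VDistinguishing A λ′

HasD′ : ∀ {n} → Digraph n → ℕ → Set
HasD′ {n} A r = Σ (Fin n → Fin n → Fin r) λ λ′ → ADistinguishing A λ′

Hasχ′D : ∀ {n} → Digraph n → ℕ → Set
Hasχ′D {n} A r =
  Σ (Fin n → Fin n → Fin r) λ λ′ → AProper A λ′ × ADistinguishing A λ′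

IsLeast : (ℕ → Set) → ℕ → Set
IsLeast P k = P k × (∀ r → P r → k ≤ r)

MaxOver : ∀ {n} → Graph n → (Digraph n → ℕ → Set) → ℕ → Set
MaxOver {n} G Has k =
  (Σ (Digraph n) λ A → IsOrientation G A × IsLeast (Has A) k) ×
  (∀ A → IsOrientation G A → ∀ d → IsLeast (Has A) d → d ≤ k)

Dmax χDmax D′max χ′Dmax : ∀ {n} → Graph n → ℕ → Set
Dmax G = MaxOver G HasD
χDmax G = MaxOver G HasχD
D′max G = MaxOver G HasD′
χ′Dmax G = MaxOver G Hasχ′D

module Submission where

-- The central
-- fact is rigidity (Oriented.Automorphism.rigid): an automorphism of an
-- orientation of C_n, n ≥ 3, fixing both ends of an edge is the identity; as
-- arcs are never reversed, mapping an edge onto itself already suffices.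
-- Upper bounds hold for every orientation: marking the edge {0, 1} gives
-- D, D′ ≤ 2; colouring the edge {p, next p} by a vertex colour of p that is
-- proper and unique at 0 gives χ′_D ≤ 3; three colourings (n odd; a vertex
-- among 1, 2, 3 transitive; arcs alternating on 0, …, 4) give χ_D ≤ 3 for
-- n ≥ 5, and distinct colours give χ_D ≤ 4.  Lower bounds: on the directed
-- cycle the rotation preserves every 1-labelling and its square every proper
-- 2-colouring; on C_4 with sources 0, 2 a transposition preserves every proper
-- 3-colouring.  Monotonicity in the number of labels yields the maxima.

open import Defs
open import Data.Nat using (ℕ; zero; suc; _+_; _∸_; _≤_; _<_; s≤s; s≤s⁻¹; _≟_; _≤?_)
open import Data.Nat.Properties using (suc-injective; +-suc; +-identityʳ; <-irrefl; m+[n∸m]≡n; ≤-reflexive; 0≢1+n; m≢1+n+m; <⇒≤; ≰⇒>)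
open import Data.Nat.GeneralisedArithmetic using (fold; fold-+)
open import Data.Fin using (Fin; zero; suc; toℕ; fromℕ; inject₁; lower₁; inject≤; #_)
import Data.Fin.Properties as FinP
open import Data.Fin.Properties using (all?; inject≤-injective; toℕ-injective; toℕ-lower₁; toℕ-fromℕ; toℕ-inject₁; toℕ<n)
open import Data.Fin.Permutation using (Permutation′; _⟨$⟩ʳ_; _⟨$⟩ˡ_; inverseˡ; permutation; _∘ₚ_; transpose)
open import Data.Product using (∃-syntax; _×_; _,_; proj₁; proj₂)
open import Data.Sum using (_⊎_; inj₁; inj₂; swap)
open import Data.Empty using (⊥; ⊥-elim)
open import Data.Bool using (Bool; true; false; _∧_)
import Data.Bool as Bool
open import Function using (_∘_)
open import Relation.Nullary using (¬_; yes; no; Dec; does)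
open import Relation.Nullary.Decidable using (dec-true; from-yes; _×-dec_; _⊎-dec_; _→-dec_; ¬?)
open import Relation.Binary.PropositionalEquality

next : ∀ {m} → Fin (suc m) → Fin (suc m)
next {m} i with m ≟ toℕ i
... | yes _   = zero
... | no m≢i = suc (lower₁ i m≢i)

prev : ∀ {m} → Fin (suc m) → Fin (suc m)
prev {m} zero = fromℕ m
prev (suc i)  = inject₁ i

next-step : ∀ {m} (u : Fin (suc m)) → CycStep (suc m) u (next u)
next-step {m} u with m ≟ toℕ u
... | yes m≡u = inj₂ (sym m≡u , refl)
... | no m≢u  = inj₁ (cong suc (toℕ-lower₁ u m≢u))

prev-step : ∀ {m} (v : Fin (suc m)) → CycStep (suc m) (prev v) v
prev-step {m} zero = inj₂ (toℕ-fromℕ m , refl)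
prev-step (suc i)  = inj₁ (cong suc (sym (toℕ-inject₁ i)))

step-next : ∀ {m} {u v : Fin (suc m)} → CycStep (suc m) u v → v ≡ next u
step-next {m} {u} {v} s with m ≟ toℕ u | s
... | yes m≡u | inj₁ v≡1+u     = ⊥-elim (<-irrefl (trans v≡1+u (cong suc (sym m≡u))) (toℕ<n v))
... | yes _   | inj₂ (_ , v≡0) = toℕ-injective v≡0
... | no m≢u  | inj₁ v≡1+u     = toℕ-injective (trans v≡1+u (cong suc (sym (toℕ-lower₁ u m≢u))))
... | no m≢u  | inj₂ (u≡m , _) = ⊥-elim (m≢u (sym u≡m))

step-prev : ∀ {m} {u v : Fin (suc m)} → CycStep (suc m) u v → u ≡ prev v
step-prev {v = zero}  (inj₁ ())
step-prev {m} {v = zero}  (inj₂ (u≡m , _)) = toℕ-injective (trans u≡m (sym (toℕ-fromℕ m)))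
step-prev {v = suc i} (inj₁ 1+i≡1+u) =
  toℕ-injective (trans (suc-injective (sym 1+i≡1+u)) (sym (toℕ-inject₁ i)))
step-prev {v = suc i} (inj₂ (_ , ()))

prev-next : ∀ {m} (u : Fin (suc m)) → prev (next u) ≡ u
prev-next u = sym (step-prev (next-step u))

next-prev : ∀ {m} (v : Fin (suc m)) → next (prev v) ≡ v
next-prev v = sym (step-next (prev-step v))

next-injective : ∀ {m} {u v : Fin (suc m)} → next u ≡ next v → u ≡ v
next-injective {u = u} {v} e = trans (sym (prev-next u)) (trans (cong prev e) (prev-next v))

neighbours : ∀ {m} {v u : Fin (suc m)} → Cycle (suc m) v u → u ≡ next v ⊎ u ≡ prev v
neighbours (inj₁ v→u) = inj₁ (step-next v→u)
neighbours (inj₂ u→v) = inj₂ (step-prev u→v)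

neighbours-adjacent : ∀ {m} {v u : Fin (suc m)} → u ≡ next v ⊎ u ≡ prev v → Cycle (suc m) v u
neighbours-adjacent {v = v} (inj₁ refl) = inj₁ (next-step v)
neighbours-adjacent {v = v} (inj₂ refl) = inj₂ (prev-step v)

step-irreflexive : ∀ {m} {u : Fin (2 + m)} → ¬ CycStep (2 + m) u u
step-irreflexive {u = u} (inj₁ u≡1+u) = m≢1+n+m (toℕ u) {0} u≡1+u
step-irreflexive (inj₂ (u≡1+m , u≡0)) = 0≢1+n (trans (sym u≡0) u≡1+m)

step-asymmetric : ∀ {m} {u v : Fin (3 + m)} → CycStep (3 + m) u v → CycStep (3 + m) v u → ⊥
step-asymmetric {u = u} (inj₁ v≡1+u) (inj₁ u≡1+v) = m≢1+n+m (toℕ u) {1} (trans u≡1+v (cong suc v≡1+u))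
step-asymmetric (inj₁ v≡1+u) (inj₂ (v≡2+m , u≡0)) =
  0≢1+n (trans (sym u≡0) (suc-injective (trans (sym v≡1+u) v≡2+m)))
step-asymmetric (inj₂ (u≡2+m , v≡0)) (inj₁ u≡1+v) =
  0≢1+n (trans (sym v≡0) (suc-injective (trans (sym u≡1+v) u≡2+m)))
step-asymmetric (inj₂ (u≡2+m , _)) (inj₂ (_ , u≡0)) = 0≢1+n (trans (sym u≡0) u≡2+m)

next≢id : ∀ {m} (u : Fin (2 + m)) → next u ≢ u
next≢id u next-u≡u = step-irreflexive (subst (CycStep _ u) next-u≡u (next-step u))

next²≢id : ∀ {m} (u : Fin (3 + m)) → next (next u) ≢ u
next²≢id u e = step-asymmetric (next-step u) (subst (CycStep _ (next u)) e (next-step (next u)))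

toℕ-prev-zero : ∀ {m} → toℕ (prev {m} zero) ≡ m
toℕ-prev-zero {m} = toℕ-fromℕ m

toℕ-next : ∀ {m} {u : Fin (suc m)} → toℕ u < m → toℕ (next u) ≡ suc (toℕ u)
toℕ-next {u = u} u<m with next-step u
... | inj₁ e          = e
... | inj₂ (u≡m , _) = ⊥-elim (<-irrefl u≡m u<m)

toℕ-walk : ∀ {m} (u : Fin (suc m)) k → toℕ u + k ≤ m → toℕ (fold u next k) ≡ toℕ u + k
toℕ-walk u zero    _ = sym (+-identityʳ (toℕ u))
toℕ-walk {m} u (suc k) u+1+k≤m = begin
    toℕ (next (fold u next k)) ≡⟨ toℕ-next (subst (_< m) (sym walk-k) u+k<m) ⟩
    suc (toℕ (fold u next k))  ≡⟨ cong suc walk-k ⟩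
    suc (toℕ u + k)            ≡⟨ sym (+-suc (toℕ u) k) ⟩
    toℕ u + suc k              ∎
  where
    open ≡-Reasoning
    u+k<m : toℕ u + k < m
    u+k<m = subst (_≤ m) (+-suc (toℕ u) k) u+1+k≤m
    walk-k : toℕ (fold u next k) ≡ toℕ u + k
    walk-k = toℕ-walk u k (<⇒≤ u+k<m)

reach : ∀ {m} (u v : Fin (suc m)) → ∃[ k ] fold u next k ≡ v
reach {m} u v = toℕ v + suc d , (begin
    fold u next (toℕ v + suc d)          ≡⟨ fold-+ u next (toℕ v) ⟩
    fold (fold u next (suc d)) next (toℕ v) ≡⟨ cong (λ w → fold w next (toℕ v)) walk-to-zero ⟩
    fold zero next (toℕ v)               ≡⟨ toℕ-injective (toℕ-walk zero (toℕ v) (s≤s⁻¹ (toℕ<n v))) ⟩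
    v                                    ∎)
  where
    open ≡-Reasoning
    d : ℕ
    d = m ∸ toℕ u
    u+d≡m : toℕ u + d ≡ m
    u+d≡m = m+[n∸m]≡n (s≤s⁻¹ (toℕ<n u))
    walk-to-zero : fold u next (suc d) ≡ zero
    walk-to-zero = sym (step-next (inj₂ (trans (toℕ-walk u d (≤-reflexive u+d≡m)) u+d≡m , refl)))

perm-injective : ∀ {n} (φ : Permutation′ n) {x y : Fin n} → φ ⟨$⟩ʳ x ≡ φ ⟨$⟩ʳ y → x ≡ y
perm-injective φ {x} {y} e = trans (sym (inverseˡ φ)) (trans (cong (φ ⟨$⟩ˡ_) e) (inverseˡ φ))

StepProper : ∀ {n} {L : Set} → (Fin n → L) → Set
StepProper {n} c = ∀ {p q} → CycStep n p q → c p ≢ c q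

ThroughArcs : ∀ {n} → Digraph n → Fin n → Fin n → Fin n → Set
ThroughArcs A x v z = (Arc A x v × Arc A v z) ⊎ (Arc A z v × Arc A v x)

Transitive : ∀ {m} → Digraph (suc m) → Fin (suc m) → Set
Transitive A v = ThroughArcs A (prev v) v (next v)

Ends : ∀ {m} → Fin (suc m) → Fin (suc m) → Set
Ends p s = s ≡ p ⊎ s ≡ next p

OnEdge : ∀ {m} → Fin (suc m) → Fin (suc m) → Fin (suc m) → Set
OnEdge p u v = (u ≡ p × v ≡ next p) ⊎ (u ≡ next p × v ≡ p)

on-edge : ∀ {m} {u v : Fin (suc m)} → Cycle (suc m) u v → ∃[ p ] OnEdge p u v
on-edge {u = u} (inj₁ u→v) = u , inj₁ (refl , step-next u→v)
on-edge {v = v} (inj₂ v→u) = v , inj₂ (step-next v→u , refl)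

ends : ∀ {m} {p u v : Fin (suc m)} → OnEdge p u v → Ends p u × Ends p v
ends (inj₁ (u≡p , v≡p′)) = inj₁ u≡p , inj₂ v≡p′
ends (inj₂ (u≡p′ , v≡p)) = inj₂ u≡p′ , inj₁ v≡p

reverse-on : ∀ {m} {p u v : Fin (suc m)} → OnEdge p u v → OnEdge p v u
reverse-on (inj₁ (u≡p , v≡p′)) = inj₂ (v≡p′ , u≡p)
reverse-on (inj₂ (u≡p′ , v≡p)) = inj₁ (v≡p , u≡p′)

traversal-distinct : ∀ {m} {p u v : Fin (2 + m)} → OnEdge p u v → u ≢ v
traversal-distinct {p = p} (inj₁ (refl , refl)) p≡p′ = next≢id p (sym p≡p′)
traversal-distinct {p = p} (inj₂ (refl , refl)) p′≡p = next≢id p p′≡p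

same-or-reversed : ∀ {m} {p u v x y : Fin (suc m)} → OnEdge p u v → OnEdge p x y →
                   (x ≡ u × y ≡ v) ⊎ (x ≡ v × y ≡ u)
same-or-reversed (inj₁ (refl , refl)) (inj₁ (refl , refl)) = inj₁ (refl , refl)
same-or-reversed (inj₁ (refl , refl)) (inj₂ (refl , refl)) = inj₂ (refl , refl)
same-or-reversed (inj₂ (refl , refl)) (inj₁ (refl , refl)) = inj₂ (refl , refl)
same-or-reversed (inj₂ (refl , refl)) (inj₂ (refl , refl)) = inj₁ (refl , refl)

common-end : ∀ {m} {p q : Fin (suc m)} → ∃[ s ] Ends p s × Ends q s → p ≡ q ⊎ q ≡ next p ⊎ p ≡ next q
common-end (_ , inj₁ s≡p  , inj₁ s≡q)  = inj₁ (trans (sym s≡p) s≡q)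
common-end (_ , inj₁ s≡p  , inj₂ s≡q′) = inj₂ (inj₂ (trans (sym s≡p) s≡q′))
common-end (_ , inj₂ s≡p′ , inj₁ s≡q)  = inj₂ (inj₁ (trans (sym s≡q) s≡p′))
common-end (_ , inj₂ s≡p′ , inj₂ s≡q′) = inj₁ (next-injective (trans (sym s≡p′) s≡q′))

distinct-ends : ∀ {m} {p a b : Fin (suc m)} → Ends p a → Ends p b → a ≢ b → OnEdge p a b
distinct-ends (inj₁ a≡p)  (inj₂ b≡p′) _   = inj₁ (a≡p , b≡p′)
distinct-ends (inj₂ a≡p′) (inj₁ b≡p)  _   = inj₂ (a≡p′ , b≡p)
distinct-ends (inj₁ a≡p)  (inj₁ b≡p)  a≢b = ⊥-elim (a≢b (trans a≡p (sym b≡p)))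
distinct-ends (inj₂ a≡p′) (inj₂ b≡p′) a≢b = ⊥-elim (a≢b (trans a≡p′ (sym b≡p′)))

shared-end : ∀ {m} {p q u v x y : Fin (suc m)} → OnEdge p u v → OnEdge q x y →
             (u ≡ x) ⊎ (u ≡ y) ⊎ (v ≡ x) ⊎ (v ≡ y) → ∃[ s ] Ends p s × Ends q s
shared-end on-p on-q (inj₁ refl)               = _ , proj₁ (ends on-p) , proj₁ (ends on-q)
shared-end on-p on-q (inj₂ (inj₁ refl))        = _ , proj₁ (ends on-p) , proj₂ (ends on-q)
shared-end on-p on-q (inj₂ (inj₂ (inj₁ refl))) = _ , proj₂ (ends on-p) , proj₁ (ends on-q)
shared-end on-p on-q (inj₂ (inj₂ (inj₂ refl))) = _ , proj₂ (ends on-p) , proj₂ (ends on-q)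

-- The arc labelling induced by a vertex labelling c of the line graph:
-- the edge {p, next p} receives the label c p.
edgeLabel : ∀ {m} {L : Set} → (Fin (suc m) → L) → Fin (suc m) → Fin (suc m) → L
edgeLabel c u v with v FinP.≟ next u
... | yes _ = c u
... | no _  = c v

edgeLabel-on : ∀ {m} {L : Set} (c : Fin (3 + m) → L) {p u v} → OnEdge p u v → edgeLabel c u v ≡ c p
edgeLabel-on c {p} (inj₁ (refl , refl)) with next p FinP.≟ next p
... | yes _    = refl
... | no  p′≢p′ = ⊥-elim (p′≢p′ refl)
edgeLabel-on c {p} (inj₂ (refl , refl)) with p FinP.≟ next (next p)
... | yes p≡p″ = ⊥-elim (next²≢id p (sym p≡p″))
... | no  _    = refl

module Oriented {m} {A : Digraph (3 + m)} (orientation : IsOrientation (Cycle (3 + m)) A) where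

  arc-edge : ∀ {u v} → Arc A u v → Cycle (3 + m) u v
  arc-edge {u} {v} = proj₁ orientation u v

  edge-arc : ∀ {u v} → Cycle (3 + m) u v → Arc A u v ⊎ Arc A v u
  edge-arc {u} {v} = proj₁ (proj₂ orientation) u v

  antisym : ∀ {u v} → Arc A u v → Arc A v u → ⊥
  antisym {u} {v} u→v v→u = proj₂ (proj₂ orientation) u v (u→v , v→u)

  edge-carries-arc : ∀ p → ∃[ x ] ∃[ y ] Arc A x y × OnEdge p x y
  edge-carries-arc p with edge-arc (inj₁ (next-step p))
  ... | inj₁ p→p′ = p , next p , p→p′ , inj₁ (refl , refl)
  ... | inj₂ p′→p = next p , p , p′→p , inj₂ (refl , refl)

  vertex-proper : ∀ {r} {c : Fin (3 + m) → Fin r} → StepProper c → VProper A c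
  vertex-proper proper u v u→v with arc-edge u→v
  ... | inj₁ u↦v = proper u↦v
  ... | inj₂ v↦u = λ cu≡cv → proper v↦u (sym cu≡cv)

  into-non-transitive : ∀ {x v z} → ¬ ThroughArcs A x v z → Arc A x v → Cycle (3 + m) v z → Arc A z v
  into-non-transitive ¬through x→v vz with edge-arc vz
  ... | inj₁ v→z = ⊥-elim (¬through (inj₁ (x→v , v→z)))
  ... | inj₂ z→v = z→v

  out-of-non-transitive : ∀ {x v z} → ¬ ThroughArcs A x v z → Arc A v x → Cycle (3 + m) v z → Arc A v z
  out-of-non-transitive ¬through v→x vz with edge-arc vz
  ... | inj₁ v→z = v→z
  ... | inj₂ z→v = ⊥-elim (¬through (inj₂ (z→v , v→x)))

  -- If c is proper along the cycle, the induced arc labelling is a proper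
  -- arc colouring: distinct arcs sharing an end lie on consecutive edges.
  edgeLabel-proper : ∀ {r} {c : Fin (3 + m) → Fin r} → StepProper c → AProper A (edgeLabel c)
  edgeLabel-proper {c = c} proper u v x y u→v x→y different shared same-label =
    clash (proj₂ (on-edge (arc-edge u→v))) (proj₂ (on-edge (arc-edge x→y)))
    where
      labels : ∀ {p q} → OnEdge p u v → OnEdge q x y → c p ≡ c q
      labels on-p on-q = trans (sym (edgeLabel-on c on-p)) (trans same-label (edgeLabel-on c on-q))
      clash : ∀ {p q} → OnEdge p u v → OnEdge q x y → ⊥
      clash {p} {q} on-p on-q with common-end (shared-end on-p on-q shared)
      ... | inj₁ refl with same-or-reversed on-p on-q
      ...   | inj₁ (x≡u , y≡v) = different (sym x≡u , sym y≡v)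
      ...   | inj₂ (x≡v , y≡u) = antisym u→v (subst₂ (Arc A) x≡v y≡u x→y)
      clash {p} {q} on-p on-q | inj₂ (inj₁ refl) = proper (next-step p) (labels on-p on-q)
      clash {p} {q} on-p on-q | inj₂ (inj₂ refl) = proper (next-step q) (sym (labels on-p on-q))

  module Automorphism (φ : Permutation′ (3 + m)) (aut : IsAut A φ) where

    image-adjacent : ∀ {u w} → Cycle (3 + m) u w → Cycle (3 + m) (φ ⟨$⟩ʳ u) (φ ⟨$⟩ʳ w)
    image-adjacent {u} {w} uw with edge-arc uw
    ... | inj₁ u→w = arc-edge (aut u w u→w)
    ... | inj₂ w→u = swap (arc-edge (aut w u w→u))

    neighbour-image : ∀ {u v w} → φ ⟨$⟩ʳ u ≡ v → Cycle (3 + m) u w →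
                      φ ⟨$⟩ʳ w ≡ next v ⊎ φ ⟨$⟩ʳ w ≡ prev v
    neighbour-image refl uw = neighbours (image-adjacent uw)

    FixesEdgeAt : Fin (3 + m) → Set
    FixesEdgeAt u = φ ⟨$⟩ʳ u ≡ u × φ ⟨$⟩ʳ next u ≡ next u

    -- Fixing the edge {u, next u} forces φ to fix the following edge:
    -- the image of next (next u) is a neighbour of next u other than u.
    fixes-following-edge : ∀ {u} → FixesEdgeAt u → FixesEdgeAt (next u)
    fixes-following-edge {u} (φu≡u , φu′≡u′) with neighbour-image φu′≡u′ (inj₁ (next-step (next u)))
    ... | inj₁ φu″≡u″ = φu′≡u′ , φu″≡u″
    ... | inj₂ φu″≡prev-u′ = ⊥-elim (next²≢id u (perm-injective φ φu″≡φu))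
      where
        φu″≡φu : φ ⟨$⟩ʳ next (next u) ≡ φ ⟨$⟩ʳ u
        φu″≡φu = trans φu″≡prev-u′ (trans (prev-next u) (sym φu≡u))

    rigid : ∀ {u} → FixesEdgeAt u → IsIdentity φ
    rigid {u} fixes v with reach u v
    ... | k , refl = proj₁ (walk k)
      where
        walk : ∀ k → FixesEdgeAt (fold u next k)
        walk zero    = fixes
        walk (suc k) = fixes-following-edge (walk k)

    no-reversal : ∀ {x y} → Arc A x y → φ ⟨$⟩ʳ x ≡ y → φ ⟨$⟩ʳ y ≡ x → ⊥
    no-reversal {x} {y} x→y φx≡y φy≡x = antisym x→y (subst₂ (Arc A) φx≡y φy≡x (aut x y x→y))

    arc-stable : ∀ {u x y} → Arc A x y → OnEdge u x y →
                 OnEdge u (φ ⟨$⟩ʳ x) (φ ⟨$⟩ʳ y) → IsIdentity φ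
    arc-stable x→y on on-φ with same-or-reversed on on-φ
    ... | inj₂ (φx≡y , φy≡x) = ⊥-elim (no-reversal x→y φx≡y φy≡x)
    ... | inj₁ (φx≡x , φy≡y) = rigid (fixes on φx≡x φy≡y)
      where
        fixes : ∀ {u x y} → OnEdge u x y → φ ⟨$⟩ʳ x ≡ x → φ ⟨$⟩ʳ y ≡ y → FixesEdgeAt u
        fixes (inj₁ (refl , refl)) φx≡x φy≡y = φx≡x , φy≡y
        fixes (inj₂ (refl , refl)) φx≡x φy≡y = φy≡y , φx≡x

    ends-stable : ∀ {u} → Ends u (φ ⟨$⟩ʳ u) → Ends u (φ ⟨$⟩ʳ next u) → IsIdentity φ
    ends-stable {u} φu-end φu′-end with edge-carries-arc u
    ... | x , y , x→y , on = arc-stable x→y on φ-on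
      where
        image-end : ∀ {x y} → OnEdge u x y → Ends u (φ ⟨$⟩ʳ x)
        image-end (inj₁ (refl , refl)) = φu-end
        image-end (inj₂ (refl , refl)) = φu′-end
        φ-on : OnEdge u (φ ⟨$⟩ʳ x) (φ ⟨$⟩ʳ y)
        φ-on = distinct-ends (image-end on) (image-end (reverse-on on))
                 (λ φx≡φy → traversal-distinct on (perm-injective φ φx≡φy))

    -- An automorphism fixing a transitive vertex is the identity: swapping
    -- its two neighbours would reverse the directed path through it.
    transitive-fixed : ∀ {v} → Transitive A v → φ ⟨$⟩ʳ v ≡ v → IsIdentity φ
    transitive-fixed {v} through φv≡v with neighbour-image φv≡v (inj₂ (prev-step v))
    ... | inj₂ φx≡x = rigid (φx≡x , subst (λ w → φ ⟨$⟩ʳ w ≡ w) (sym (next-prev v)) φv≡v)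
    ... | inj₁ φx≡z = ⊥-elim (swapped through)
      where
        φz≡x : φ ⟨$⟩ʳ next v ≡ prev v
        φz≡x with neighbour-image φv≡v (inj₁ (next-step v))
        ... | inj₂ φz≡x = φz≡x
        ... | inj₁ φz≡z = ⊥-elim (next²≢id v (trans (cong next z≡x) (next-prev v)))
          where
            z≡x : next v ≡ prev v
            z≡x = perm-injective φ (trans φz≡z (sym φx≡z))
        swapped : ¬ Transitive A v
        swapped (inj₁ (x→v , v→z)) = antisym v→z (subst₂ (Arc A) φx≡z φv≡v (aut _ _ x→v))
        swapped (inj₂ (z→v , v→x)) = antisym v→x (subst₂ (Arc A) φz≡x φv≡v (aut _ _ z→v))

    fixes-edge-by-label : ∀ {L : Set} (c : Fin (3 + m) → L) → (∀ w → c (φ ⟨$⟩ʳ w) ≡ c w) →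
                          ∀ {u} → c (next u) ≢ c (prev u) → φ ⟨$⟩ʳ u ≡ u → FixesEdgeAt u
    fixes-edge-by-label c preserves {u} distinct φu≡u with neighbour-image φu≡u (inj₁ (next-step u))
    ... | inj₁ φu′≡u′ = φu≡u , φu′≡u′
    ... | inj₂ φu′≡x  = ⊥-elim (distinct (trans (sym (preserves (next u))) (cong c φu′≡x)))

  -- If c(0) is a label that c gives to no other vertex, the induced arc
  -- labelling is distinguishing: a preserving automorphism maps the arc on
  -- the edge {0, next 0} onto that edge.
  edgeLabel-distinguishing : ∀ {r} {c : Fin (3 + m) → Fin r} →
                             (∀ p → c p ≡ c zero → p ≡ zero) → ADistinguishing A (edgeLabel c)
  edgeLabel-distinguishing {c = c} unique φ aut preserves with edge-carries-arc zero
  ... | x , y , x→y , on with on-edge (arc-edge (aut x y x→y))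
  ...   | p , on-φ = arc-stable x→y on (subst (λ q → OnEdge q _ _) p≡0 on-φ)
    where
      open Automorphism φ aut
      p≡0 : p ≡ zero
      p≡0 = unique p (begin
        c p                                  ≡⟨ sym (edgeLabel-on c on-φ) ⟩
        edgeLabel c (φ ⟨$⟩ʳ x) (φ ⟨$⟩ʳ y)    ≡⟨ preserves x y x→y ⟩
        edgeLabel c x y                      ≡⟨ edgeLabel-on c on ⟩
        c zero                               ∎)
        where open ≡-Reasoning

-- D ≤ 2 on every orientation: mark the two ends of the edge {0, 1}.
firstEdge : ∀ {m} → Fin (3 + m) → Fin 2
firstEdge zero          = # 1
firstEdge (suc zero)    = # 1
firstEdge (suc (suc _)) = # 0

firstEdge-marks : ∀ {m} {u : Fin (3 + m)} → firstEdge u ≡ # 1 → Ends zero u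
firstEdge-marks {u = zero}          _ = inj₁ refl
firstEdge-marks {u = suc zero}      _ = inj₂ refl
firstEdge-marks {u = suc (suc _)} ()

hasD-2 : ∀ {m} {A : Digraph (3 + m)} → IsOrientation (Cycle (3 + m)) A → HasD A 2
hasD-2 orientation = firstEdge , λ φ aut preserves →
  Automorphism.ends-stable φ aut (firstEdge-marks (preserves zero)) (firstEdge-marks (preserves (next zero)))
  where open Oriented orientation

-- D′ ≤ 2 on every orientation: mark only the arc on the edge {0, 1}.
isZero : ∀ {m} → Fin (suc m) → Fin 2
isZero zero    = # 1
isZero (suc _) = # 0

hasD′-2 : ∀ {m} {A : Digraph (3 + m)} → IsOrientation (Cycle (3 + m)) A → HasD′ A 2
hasD′-2 {m} orientation = edgeLabel isZero , edgeLabel-distinguishing only-zero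
  where
    open Oriented orientation
    only-zero : ∀ (p : Fin (3 + m)) → isZero p ≡ isZero {2 + m} zero → p ≡ zero
    only-zero zero    _  = refl
    only-zero (suc _) ()

sequence-proper : ∀ {m r} (f : ℕ → Fin r) → (∀ t → f t ≢ f (suc t)) → f m ≢ f 0 →
                  StepProper {suc m} (f ∘ toℕ)
sequence-proper f changes wrap {p} (inj₁ q≡1+p) rewrite q≡1+p = changes (toℕ p)
sequence-proper f changes wrap (inj₂ (p≡m , q≡0)) rewrite p≡m | q≡0 = wrap

alternate : ℕ → Fin 3
alternate zero          = # 0
alternate (suc zero)    = # 1
alternate (suc (suc t)) = alternate t

alternate-changes : ∀ t → alternate t ≢ alternate (suc t)
alternate-changes zero          ()
alternate-changes (suc zero)    ()
alternate-changes (suc (suc t)) = alternate-changes t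

alternate≢2 : ∀ t → alternate t ≢ # 2
alternate≢2 zero          ()
alternate≢2 (suc zero)    ()
alternate≢2 (suc (suc t)) = alternate≢2 t

alternate-parity : ∀ t → alternate t ≡ # 0 ⊎ alternate t ≡ # 1
alternate-parity zero          = inj₁ refl
alternate-parity (suc zero)    = inj₂ refl
alternate-parity (suc (suc t)) = alternate-parity t

special : ℕ → ℕ → Fin 3
special j t with t ≟ j
... | yes _ = # 2
... | no _  = alternate t

special-changes : ∀ j t → special j t ≢ special j (suc t)
special-changes j t with t ≟ j | suc t ≟ j
... | yes refl | yes 1+j≡j = ⊥-elim (m≢1+n+m j {0} (sym 1+j≡j))
... | yes _    | no _      = alternate≢2 (suc t) ∘ sym
... | no _     | yes _     = alternate≢2 t
... | no _     | no _      = alternate-changes t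

special-unique : ∀ j t → special j t ≡ # 2 → t ≡ j
special-unique j t with t ≟ j
... | yes t≡j = λ _ → t≡j
... | no _    = λ alternate≡2 → ⊥-elim (alternate≢2 t alternate≡2)

special-at : ∀ j → special j j ≡ # 2
special-at j with j ≟ j
... | yes _   = refl
... | no j≢j  = ⊥-elim (j≢j refl)

-- χ′_D ≤ 3 on every orientation: the arc colouring induced by special 0;
-- colour 2 then appears only on the edge {0, 1}.
hasχ′D-3 : ∀ {m} {A : Digraph (3 + m)} → IsOrientation (Cycle (3 + m)) A → Hasχ′D A 3
hasχ′D-3 {m} orientation =
  edgeLabel c ,
  edgeLabel-proper (sequence-proper (special 0) (special-changes 0) (alternate≢2 (2 + m))) ,
  edgeLabel-distinguishing (λ p c≡2 → toℕ-injective (special-unique 0 (toℕ p) c≡2))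
  where
    open Oriented orientation
    c : Fin (3 + m) → Fin 3
    c = special 0 ∘ toℕ

directed : ∀ {m} → Digraph (suc m)
directed u v = does (v FinP.≟ next u)

witness : ∀ {P : Set} (P? : Dec P) → does P? ≡ true → P
witness (yes p) _  = p
witness (no _)  ()

arc-directed : ∀ {m} {u v : Fin (suc m)} → Arc directed u v → v ≡ next u
arc-directed {u = u} {v} = witness (v FinP.≟ next u)

directed-arc : ∀ {m} (u : Fin (suc m)) → Arc directed u (next u)
directed-arc u = dec-true (next u FinP.≟ next u) refl

directed-orientation : ∀ {m} → IsOrientation (Cycle (3 + m)) directed
directed-orientation = arcs-are-edges , edges-are-arcs , λ u v (u→v , v→u) →
    next²≢id u (sym (trans (arc-directed v→u) (cong next (arc-directed u→v))))
  where
    arcs-are-edges : ∀ u v → Arc directed u v → Cycle _ u v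
    arcs-are-edges u v u→v = inj₁ (subst (CycStep _ u) (sym (arc-directed u→v)) (next-step u))
    edges-are-arcs : ∀ u v → Cycle _ u v → Arc directed u v ⊎ Arc directed v u
    edges-are-arcs u v uv with neighbours uv
    ... | inj₁ refl = inj₁ (directed-arc u)
    ... | inj₂ refl = inj₂ (subst (Arc directed (prev u)) (next-prev u) (directed-arc (prev u)))

rotation : ∀ {m} → Permutation′ (suc m)
rotation = permutation next prev next-prev prev-next

rotation-aut : ∀ {m} → IsAut (directed {m}) rotation
rotation-aut u v u→v =
  subst (λ w → Arc directed (next u) (next w)) (sym (arc-directed u→v)) (directed-arc (next u))

rotation²-aut : ∀ {m} → IsAut (directed {m}) (rotation ∘ₚ rotation)
rotation²-aut u v u→v = rotation-aut (next u) (next v) (rotation-aut u v u→v)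

-- One label cannot break the rotation.
single-label : (a b : Fin 1) → a ≡ b
single-label zero zero = refl

no-D-1 : ∀ {m} → ¬ HasD (directed {2 + m}) 1
no-D-1 (_ , distinguishing) =
  next≢id zero (distinguishing rotation rotation-aut (λ _ → single-label _ _) zero)

no-D′-1 : ∀ {m} → ¬ HasD′ (directed {2 + m}) 1
no-D′-1 (_ , distinguishing) =
  next≢id zero (distinguishing rotation rotation-aut (λ _ _ _ → single-label _ _) zero)

two-colours : (a b c : Fin 2) → a ≢ b → b ≢ c → a ≡ c
two-colours zero       zero       _          a≢b _   = ⊥-elim (a≢b refl)
two-colours (suc zero) (suc zero) _          a≢b _   = ⊥-elim (a≢b refl)
two-colours zero       (suc zero) zero       _   _   = refl
two-colours (suc zero) zero       (suc zero) _   _   = refl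
two-colours _          zero       zero       _   b≢c = ⊥-elim (b≢c refl)
two-colours _          (suc zero) (suc zero) _   b≢c = ⊥-elim (b≢c refl)

-- Hence a proper 2-colouring of the directed cycle, of its vertices or of
-- its arcs, is preserved by rotating twice.
no-χD-2 : ∀ {m} → ¬ HasχD (directed {2 + m}) 2
no-χD-2 (c , proper , distinguishing) =
  next²≢id zero (distinguishing (rotation ∘ₚ rotation) rotation²-aut repeats zero)
  where
    repeats : ∀ u → c (next (next u)) ≡ c u
    repeats u = sym (two-colours _ _ _ (proper _ _ (directed-arc u)) (proper _ _ (directed-arc (next u))))

no-χ′D-2 : ∀ {m} → ¬ Hasχ′D (directed {2 + m}) 2
no-χ′D-2 (λ′ , proper , distinguishing) =
  next²≢id zero (distinguishing (rotation ∘ₚ rotation) rotation²-aut repeats zero)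
  where
    following-differ : ∀ u → λ′ u (next u) ≢ λ′ (next u) (next (next u))
    following-differ u = proper _ _ _ _ (directed-arc u) (directed-arc (next u))
      (λ (u≡u′ , _) → next≢id u (sym u≡u′)) (inj₂ (inj₂ (inj₁ refl)))
    repeats : ∀ u v → Arc directed u v → λ′ (next (next u)) (next (next v)) ≡ λ′ u v
    repeats u v u→v with refl ← arc-directed {u = u} {v} u→v =
      sym (two-colours _ _ _ (following-differ u) (following-differ (next u)))

arc? : ∀ {n} (A : Digraph n) u v → Dec (Arc A u v)
arc? A u v = A u v Bool.≟ true

aut? : ∀ {n} (A : Digraph n) (φ : Permutation′ n) → Dec (IsAut A φ)
aut? A φ = all? λ u → all? λ v → arc? A u v →-dec arc? A (φ ⟨$⟩ʳ u) (φ ⟨$⟩ʳ v)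

neighbour? : ∀ {m} (v u : Fin (suc m)) → Dec (u ≡ next v ⊎ u ≡ prev v)
neighbour? v u = (u FinP.≟ next v) ⊎-dec (u FinP.≟ prev v)

source : Fin 4 → Bool
source zero                = true
source (suc zero)          = false
source (suc (suc zero))    = true
source (suc (suc (suc _))) = false

sources02 : Digraph 4
sources02 u v = source u ∧ does (neighbour? u v)

sources02-orientation : IsOrientation (Cycle 4) sources02
sources02-orientation =
  (λ u v u→v → neighbours-adjacent (arcs-join-neighbours u v u→v)) ,
  (λ u v uv → neighbours-are-joined u v (neighbours uv)) ,
  antisymmetric
  where
    arcs-join-neighbours : ∀ u v → Arc sources02 u v → v ≡ next u ⊎ v ≡ prev u
    arcs-join-neighbours = from-yes (all? λ u → all? λ v → arc? sources02 u v →-dec neighbour? u v)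
    neighbours-are-joined : ∀ u v → v ≡ next u ⊎ v ≡ prev u → Arc sources02 u v ⊎ Arc sources02 v u
    neighbours-are-joined = from-yes (all? λ u → all? λ v →
      neighbour? u v →-dec (arc? sources02 u v ⊎-dec arc? sources02 v u))
    antisymmetric : ∀ u v → ¬ (Arc sources02 u v × Arc sources02 v u)
    antisymmetric = from-yes (all? λ u → all? λ v → ¬? (arc? sources02 u v ×-dec arc? sources02 v u))

third-colour : (a b x y : Fin 3) → a ≢ b → x ≢ a → x ≢ b → y ≢ a → y ≢ b → x ≡ y
third-colour = from-yes (all? λ (a : Fin 3) → all? λ (b : Fin 3) → all? λ (x : Fin 3) → all? λ (y : Fin 3) →
  ¬? (a FinP.≟ b) →-dec ¬? (x FinP.≟ a) →-dec ¬? (x FinP.≟ b) →-dec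
  ¬? (y FinP.≟ a) →-dec ¬? (y FinP.≟ b) →-dec x FinP.≟ y)

-- In a proper 3-colouring of this orientation, either 0 and 2 or 1 and 3
-- share a colour; the transposition swapping them is an automorphism.
no-χD-3 : ¬ HasχD sources02 3
no-χD-3 (c , proper , distinguishing) with c (# 0) FinP.≟ c (# 2)
... | yes c0≡c2 = moved (distinguishing swap02 (from-yes (aut? sources02 swap02)) preserved (# 0))
  where
    swap02 : Permutation′ 4
    swap02 = transpose (# 0) (# 2)
    moved : # 2 ≢ # 0
    moved ()
    preserved : ∀ u → c (swap02 ⟨$⟩ʳ u) ≡ c u
    preserved zero                      = sym c0≡c2
    preserved (suc zero)                = refl
    preserved (suc (suc zero))          = c0≡c2
    preserved (suc (suc (suc zero)))    = refl
... | no c0≢c2 = moved (distinguishing swap13 (from-yes (aut? sources02 swap13)) preserved (# 1))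
  where
    swap13 : Permutation′ 4
    swap13 = transpose (# 1) (# 3)
    moved : # 3 ≢ # 1
    moved ()
    c1≡c3 : c (# 1) ≡ c (# 3)
    c1≡c3 = third-colour (c (# 0)) (c (# 2)) (c (# 1)) (c (# 3)) c0≢c2
      (proper (# 0) (# 1) refl ∘ sym) (proper (# 2) (# 1) refl ∘ sym)
      (proper (# 0) (# 3) refl ∘ sym) (proper (# 2) (# 3) refl ∘ sym)
    preserved : ∀ u → c (swap13 ⟨$⟩ʳ u) ≡ c u
    preserved zero                      = refl
    preserved (suc zero)                = sym c1≡c3
    preserved (suc (suc zero))          = refl
    preserved (suc (suc (suc zero)))    = c1≡c3

hasχD-identity : ∀ {m} {A : Digraph (2 + m)} → IsOrientation (Cycle (2 + m)) A → HasχD A (2 + m)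
hasχD-identity {m} {A} (arcs-are-edges , _) = (λ u → u) , proper , λ _ _ fixes → fixes
  where
    no-loop : ∀ {u} → ¬ Cycle (2 + m) u u
    no-loop (inj₁ u↦u) = step-irreflexive u↦u
    no-loop (inj₂ u↦u) = step-irreflexive u↦u
    proper : VProper A (λ u → u)
    proper u v u→v u≡v = no-loop (subst (Cycle (2 + m) u) (sym u≡v) (arcs-are-edges u v u→v))

_ᵀ : ∀ {n} → Digraph n → Digraph n
(A ᵀ) u v = A v u

ᵀ-orientation : ∀ {n} {A : Digraph n} → IsOrientation (Cycle n) A → IsOrientation (Cycle n) (A ᵀ)
ᵀ-orientation (arcs-are-edges , edges-are-arcs , antisymmetric) =
  (λ u v v→u → swap (arcs-are-edges v u v→u)) ,
  (λ u v uv → swap (edges-are-arcs u v uv)) ,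
  (λ u v (v→u , u→v) → antisymmetric u v (u→v , v→u))

ᵀ-aut : ∀ {n} {A : Digraph n} {φ : Permutation′ n} → IsAut A φ → IsAut (A ᵀ) φ
ᵀ-aut aut u v v→u = aut v u v→u

ᵀ-through : ∀ {n} {A : Digraph n} {x v z} → ThroughArcs (A ᵀ) x v z → ThroughArcs A x v z
ᵀ-through (inj₁ (v→x , z→v)) = inj₂ (z→v , v→x)
ᵀ-through (inj₂ (v→z , x→v)) = inj₁ (x→v , v→z)

transitive? : ∀ {m} (A : Digraph (suc m)) v → Dec (Transitive A v)
transitive? A v = (arc? A (prev v) v ×-dec arc? A v (next v)) ⊎-dec (arc? A (next v) v ×-dec arc? A v (prev v))

-- If 1, 2, 3 are not transitive, the arcs alternate along 0, …, 4; when
-- 0 → 1 this makes 3 a sink, so no automorphism maps 0 to 3.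
not-onto-3 : ∀ {k} {A : Digraph (5 + k)} → IsOrientation (Cycle (5 + k)) A →
             ¬ Transitive A (# 1) → ¬ Transitive A (# 2) → ¬ Transitive A (# 3) →
             Arc A (# 0) (# 1) → ∀ φ → IsAut A φ → φ ⟨$⟩ʳ # 0 ≢ # 3
not-onto-3 {A = A} orientation ¬t₁ ¬t₂ ¬t₃ 0→1 φ aut φ0≡3 =
  image-of-1 (neighbour-image φ0≡3 (inj₁ (next-step (# 0))))
  where
    open Oriented orientation
    open Automorphism φ aut
    2→1 : Arc A (# 2) (# 1)
    2→1 = into-non-transitive ¬t₁ 0→1 (inj₁ (next-step (# 1)))
    2→3 : Arc A (# 2) (# 3)
    2→3 = out-of-non-transitive ¬t₂ 2→1 (inj₁ (next-step (# 2)))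
    4→3 : Arc A (# 4) (# 3)
    4→3 = into-non-transitive ¬t₃ 2→3 (inj₁ (next-step (# 3)))
    3→φ1 : Arc A (# 3) (φ ⟨$⟩ʳ # 1)
    3→φ1 = subst (λ w → Arc A w (φ ⟨$⟩ʳ # 1)) φ0≡3 (aut _ _ 0→1)
    image-of-1 : φ ⟨$⟩ʳ # 1 ≡ # 4 ⊎ φ ⟨$⟩ʳ # 1 ≡ # 2 → ⊥
    image-of-1 (inj₁ φ1≡4) = antisym (subst (Arc A (# 3)) φ1≡4 3→φ1) 4→3
    image-of-1 (inj₂ φ1≡2) = antisym (subst (Arc A (# 3)) φ1≡2 3→φ1) 2→3

twoMarks : ℕ → Fin 3
twoMarks 0 = # 2
twoMarks 1 = # 0
twoMarks 2 = # 1
twoMarks 3 = # 2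
twoMarks (suc (suc (suc (suc t)))) = alternate t

twoMarks-changes : ∀ t → twoMarks t ≢ twoMarks (suc t)
twoMarks-changes 0 ()
twoMarks-changes 1 ()
twoMarks-changes 2 ()
twoMarks-changes 3 ()
twoMarks-changes (suc (suc (suc (suc t)))) = alternate-changes t

twoMarks-2 : ∀ t → twoMarks t ≡ # 2 → t ≡ 0 ⊎ t ≡ 3
twoMarks-2 0 _ = inj₁ refl
twoMarks-2 1 ()
twoMarks-2 2 ()
twoMarks-2 3 _ = inj₂ refl
twoMarks-2 (suc (suc (suc (suc t)))) alternate≡2 = ⊥-elim (alternate≢2 t alternate≡2)

module FiveOrMore {k} {A : Digraph (5 + k)} (orientation : IsOrientation (Cycle (5 + k)) A) where
  open Oriented orientation

  -- n odd: recolour 0 by 2; the neighbours 1 and n - 1 of 0 then get the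
  -- different colours 1 and 0, so the edge {0, 1} is fixed.
  odd-colouring : alternate (4 + k) ≡ # 0 → HasχD A 3
  odd-colouring n-odd =
    c , vertex-proper (sequence-proper (special 0) (special-changes 0) (alternate≢2 (4 + k))) , distinguishing
    where
      c : Fin (5 + k) → Fin 3
      c = special 0 ∘ toℕ
      sides : c (next zero) ≢ c (prev zero)
      sides c1≡cm with trans c1≡cm (trans (cong (special 0) (toℕ-prev-zero {4 + k})) n-odd)
      ... | ()
      distinguishing : VDistinguishing A c
      distinguishing φ aut preserves = rigid (fixes-edge-by-label c preserves sides φ0≡0)
        where
          open Automorphism φ aut
          φ0≡0 : φ ⟨$⟩ʳ zero ≡ zero
          φ0≡0 = toℕ-injective (special-unique 0 _ (preserves zero))

  -- n even and some vertex v transitive: recolour v alone by 2.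
  transitive-colouring : ∀ v → Transitive A v →
                         special (toℕ v) (4 + k) ≢ special (toℕ v) 0 → HasχD A 3
  transitive-colouring v transitive wrap =
    c , vertex-proper (sequence-proper (special (toℕ v)) (special-changes (toℕ v)) wrap) , distinguishing
    where
      c : Fin (5 + k) → Fin 3
      c = special (toℕ v) ∘ toℕ
      distinguishing : VDistinguishing A c
      distinguishing φ aut preserves = transitive-fixed transitive φv≡v
        where
          open Automorphism φ aut
          φv≡v : φ ⟨$⟩ʳ v ≡ v
          φv≡v = toℕ-injective (special-unique (toℕ v) _ (trans (preserves v) (special-at (toℕ v))))

  -- n even and 1, 2, 3 not transitive: colour 0 and 3 by 2.  An automorphism
  -- cannot map 0 to 3 (in A or in its reverse), and the neighbours of 0 get
  -- the different colours 0 and 1.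
  alternating-colouring : alternate (4 + k) ≡ # 1 →
    ¬ Transitive A (# 1) → ¬ Transitive A (# 2) → ¬ Transitive A (# 3) → HasχD A 3
  alternating-colouring n-even ¬t₁ ¬t₂ ¬t₃ =
    c , vertex-proper (sequence-proper twoMarks twoMarks-changes (alternate≢2 k)) , distinguishing
    where
      c : Fin (5 + k) → Fin 3
      c = twoMarks ∘ toℕ
      sides : c (next zero) ≢ c (prev zero)
      sides c1≡cm with trans c1≡cm (trans (cong twoMarks (toℕ-prev-zero {4 + k})) n-even)
      ... | ()
      not-to-3 : ∀ φ → IsAut A φ → φ ⟨$⟩ʳ # 0 ≢ # 3
      not-to-3 φ aut with edge-arc (inj₁ (next-step (# 0)))
      ... | inj₁ 0→1 = not-onto-3 orientation ¬t₁ ¬t₂ ¬t₃ 0→1 φ aut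
      ... | inj₂ 1→0 = not-onto-3 (ᵀ-orientation {A = A} orientation)
                         (reversed ¬t₁) (reversed ¬t₂) (reversed ¬t₃) 1→0 φ (ᵀ-aut {A = A} {φ} aut)
        where
          reversed : ∀ {v} → ¬ Transitive A v → ¬ Transitive (A ᵀ) v
          reversed ¬t = ¬t ∘ ᵀ-through {A = A}
      distinguishing : VDistinguishing A c
      distinguishing φ aut preserves with twoMarks-2 _ (preserves zero)
      ... | inj₁ φ0≡0 = rigid (fixes-edge-by-label c preserves sides (toℕ-injective φ0≡0))
        where open Automorphism φ aut
      ... | inj₂ φ0≡3 = ⊥-elim (not-to-3 φ aut (toℕ-injective φ0≡3))

  wrap-even : alternate (4 + k) ≡ # 1 → alternate (4 + k) ≢ # 0
  wrap-even n-even alternate≡0 with trans (sym n-even) alternate≡0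
  ... | ()

  hasχD-3 : HasχD A 3
  hasχD-3 with alternate-parity (4 + k)
  ... | inj₁ n-odd = odd-colouring n-odd
  ... | inj₂ n-even with transitive? A (# 1) | transitive? A (# 2) | transitive? A (# 3)
  ...   | yes t₁ | _      | _      = transitive-colouring (# 1) t₁ (wrap-even n-even)
  ...   | no _   | yes t₂ | _      = transitive-colouring (# 2) t₂ (wrap-even n-even)
  ...   | no _   | no _   | yes t₃ = transitive-colouring (# 3) t₃ (wrap-even n-even)
  ...   | no ¬t₁ | no ¬t₂ | no ¬t₃ = alternating-colouring n-even ¬t₁ ¬t₂ ¬t₃

Monotone : ∀ {n} → (Digraph n → ℕ → Set) → Set
Monotone {n} Has = ∀ (A : Digraph n) {r s} → Has A r → r ≤ s → Has A s

widen-injective : ∀ {r s} (r≤s : r ≤ s) {i j : Fin r} → inject≤ i r≤s ≡ inject≤ j r≤s → i ≡ j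
widen-injective r≤s {i} {j} = inject≤-injective r≤s r≤s i j

monotone-D : ∀ {n} → Monotone {n} HasD
monotone-D A (c , dist) r≤s =
  (λ u → inject≤ (c u) r≤s) , λ φ aut pres → dist φ aut (λ u → widen-injective r≤s (pres u))

monotone-D′ : ∀ {n} → Monotone {n} HasD′
monotone-D′ A (c , dist) r≤s =
  (λ u v → inject≤ (c u v) r≤s) , λ φ aut pres → dist φ aut (λ u v a → widen-injective r≤s (pres u v a))

monotone-χD : ∀ {n} → Monotone {n} HasχD
monotone-χD A (c , proper , dist) r≤s =
  (λ u → inject≤ (c u) r≤s) ,
  (λ u v a → proper u v a ∘ widen-injective r≤s) ,
  λ φ aut pres → dist φ aut (λ u → widen-injective r≤s (pres u))

monotone-χ′D : ∀ {n} → Monotone {n} Hasχ′D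
monotone-χ′D A (c , proper , dist) r≤s =
  (λ u v → inject≤ (c u v) r≤s) ,
  (λ u v x y a b different shared → proper u v x y a b different shared ∘ widen-injective r≤s) ,
  λ φ aut pres → dist φ aut (λ u v a → widen-injective r≤s (pres u v a))

maximum : ∀ {n} {G : Graph n} {Has : Digraph n → ℕ → Set} k → Monotone Has →
          (A₀ : Digraph n) → IsOrientation G A₀ → ¬ Has A₀ k →
          (∀ A → IsOrientation G A → Has A (suc k)) → MaxOver G Has (suc k)
maximum {Has = Has} k monotone A₀ orientation₀ ¬k enough =
  (A₀ , orientation₀ , enough A₀ orientation₀ , least) , λ A orientation _ d-least →
    proj₂ d-least (suc k) (enough A orientation)
  where
    least : ∀ r → Has A₀ r → suc k ≤ r
    least r has-r with suc k ≤? r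
    ... | yes k<r = k<r
    ... | no  k≮r = ⊥-elim (¬k (monotone A₀ has-r (s≤s⁻¹ (≰⇒> k≮r))))

Dmax-cycle : ∀ m → Dmax (Cycle (3 + m)) 2
Dmax-cycle m = maximum 1 monotone-D directed directed-orientation no-D-1 (λ _ → hasD-2)

D′max-cycle : ∀ m → D′max (Cycle (3 + m)) 2
D′max-cycle m = maximum 1 monotone-D′ directed directed-orientation no-D′-1 (λ _ → hasD′-2)

χ′Dmax-cycle : ∀ m → χ′Dmax (Cycle (3 + m)) 3
χ′Dmax-cycle m = maximum 2 monotone-χ′D directed directed-orientation no-χ′D-2 (λ _ → hasχ′D-3)

χDmax-C4 : χDmax (Cycle 4) 4
χDmax-C4 = maximum 3 monotone-χD sources02 sources02-orientation no-χD-3 (λ _ → hasχD-identity)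

χDmax-cycle : ∀ k → χDmax (Cycle (5 + k)) 3
χDmax-cycle k = maximum 2 monotone-χD directed directed-orientation no-χD-2 (λ _ → FiveOrMore.hasχD-3)

theorem7 :
    ((n : ℕ) → 4 ≤ n → Dmax (Cycle n) 2 × D′max (Cycle n) 2) ×
    (χDmax (Cycle 4) 4 × ((n : ℕ) → 5 ≤ n → χDmax (Cycle n) 3)) ×
    ((n : ℕ) → 4 ≤ n → χ′Dmax (Cycle n) 3)
theorem7 = part1 , (χDmax-C4 , part2) , part3
  where
    part1 : (n : ℕ) → 4 ≤ n → Dmax (Cycle n) 2 × D′max (Cycle n) 2
    part1 (suc (suc (suc m))) (s≤s (s≤s (s≤s _))) = Dmax-cycle m , D′max-cycle m
    part2 : (n : ℕ) → 5 ≤ n → χDmax (Cycle n) 3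
    part2 (suc (suc (suc (suc (suc k))))) (s≤s (s≤s (s≤s (s≤s (s≤s _))))) = χDmax-cycle k
    part3 : (n : ℕ) → 4 ≤ n → χ′Dmax (Cycle n) 3
    part3 (suc (suc (suc m))) (s≤s (s≤s (s≤s _))) = χ′Dmax-cycle m
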